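{- Let $f:2^V\to\mathbb{Z}$ be submodular with $f(\emptyset)=0$, $|V|=n$, and let $\mathcal{F}$ be a ring family on $V$ given by an acyclic digraph $D=(V,A)$. If $y\in\mathcal{B}(f)$ is non-degenerate and satisfies $y_i<-(n-1)\max_jy_j$, then $i$ is contained in every minimizer of $f$ over $\mathcal{F}$.
   Context: The ring family represented by $D=(V,A)$ is $\mathcal{F}=\{S\subseteq V:\text{for every }(i,j)\in A,\ i\in S\Rightarrow j\in S\}$ (it contains $\emptyset$ and $V$). The base polyhedron is $\mathcal{B}(f)=\{y\in\mathbb{R}^V: y(S)\le f(S)\ \forall S\subsetneq V,\ y(V)=f(V)\}$ with $y(S)=\sum_{i\in S}y_i$. A vector $y\in\mathcal{B}(f)$ is non-degenerate if it has both positive and negative entries.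
   Formalization: The vector y in $\mathcal{B}(f)$ has rational entries rather than real ones. -}

module Defs where

open import Data.Nat using (ℕ; zero; suc)
open import Data.Integer as ℤ using (ℤ; +_)
open import Data.Rational as ℚ using (ℚ; 0ℚ; _⊔_; _+_; _*_; -_; _<_; _≤_)
open import Data.Fin using (Fin; zero; suc)
open import Data.Fin.Subset using (Subset; _∪_; _∩_; _∈_; _⊂_; ⊤; ⊥)
open import Data.Vec using (lookup; tail)
open import Data.Bool using (if_then_else_)
open import Data.Product using (_×_; ∃)
open import Relation.Nullary using (¬_)
open import Relation.Binary.PropositionalEquality using (_≡_)
open import Relation.Binary.Construct.Closure.Transitive using (TransClosure)

ℤtoℚ : ℤ → ℚ
ℤtoℚ z = z ℚ./ 1

ℕtoℚ : ℕ → ℚ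
ℕtoℚ k = (+ k) ℚ./ 1

SetFun : ℕ → Set
SetFun n = Subset n → ℤ

Submodular : ∀ {n} → SetFun n → Set
Submodular f = ∀ S T → f (S ∪ T) ℤ.+ f (S ∩ T) ℤ.≤ f S ℤ.+ f T

Digraph : ℕ → Set₁
Digraph n = Fin n → Fin n → Set

Acyclic : ∀ {n} → Digraph n → Set
Acyclic A = ∀ i → ¬ TransClosure A i i

InRingFamily : ∀ {n} → Digraph n → Subset n → Set
InRingFamily A S = ∀ i j → A i j → i ∈ S → j ∈ S

ySum : ∀ {n} → (Fin n → ℚ) → Subset n → ℚ
ySum {zero} y S = 0ℚ
ySum {suc n} y S =
  (if lookup S zero then y zero else 0ℚ) + ySum (λ i → y (suc i)) (tail S)

InBase : ∀ {n} → SetFun n → (Fin n → ℚ) → Set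
InBase f y = (∀ S → S ⊂ ⊤ → ySum y S ≤ ℤtoℚ (f S)) × (ySum y ⊤ ≡ ℤtoℚ (f ⊤))

NonDegenerate : ∀ {n} → (Fin n → ℚ) → Set
NonDegenerate y = (∃ λ j → 0ℚ < y j) × (∃ λ j → y j < 0ℚ)

maxEntry : ∀ {m} → (Fin (suc m) → ℚ) → ℚ
maxEntry {zero} y = y zero
maxEntry {suc m} y = y zero ⊔ maxEntry (λ i → y (suc i))

IsMinimizer : ∀ {n} → Digraph n → SetFun n → Subset n → Set
IsMinimizer A f S = InRingFamily A S × (∀ T → InRingFamily A T → f S ℤ.≤ f T)

{-# OPTIONS --safe #-}
-- If i ∉ S for a minimiser S, then S is a proper subset of V and V lies in the ring family,
-- so y(S) ≤ f(S) ≤ f(V) = y(V).  On the other hand y(V) = y(S) + y(V ∖ S), and the entries of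
-- V ∖ S other than y_i number at most n - 1 and are each at most max_j y_j, which is
-- non-negative because y has a positive entry.  Hence y(V) ≤ y(S) + y_i + (n - 1) max_j y_j,
-- which is < y(S) by the hypothesis on y_i: a contradiction.
module Submission where

open import Defs
open import Data.Nat using (ℕ; suc)
open import Data.Integer using (+_)
open import Data.Rational using (_<_; _*_; -_)
open import Data.Fin using (Fin)
open import Data.Fin.Subset using (Subset; ⊥; _∈_)
open import Data.Rational using (ℚ)
open import Relation.Binary.PropositionalEquality using (_≡_)

open import Data.Bool using (true; false; not; if_then_else_)
open import Data.Empty using (⊥-elim)
open import Data.Fin using (zero; suc)
open import Data.Fin.Subset using (_⊂_; ⊤; ∁)
open import Data.Fin.Subset.Properties using (∈⊤; ⊆⊤; _∈?_; x∉p⇒x∈∁p)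
import Data.Integer as ℤ
import Data.Integer.Properties as ℤ
open import Data.Product using (∃; _,_)
open import Data.Rational using (0ℚ; 1ℚ; _+_; _≤_; toℚᵘ)
open import Data.Rational.Properties
import Data.Rational.Unnormalised as ℚᵘ
import Data.Rational.Unnormalised.Properties as ℚᵘ
open import Data.Vec using ([]; _∷_; here; there)
open import Relation.Binary.PropositionalEquality using (refl; sym; trans; cong; module ≡-Reasoning)
open import Relation.Nullary using (yes; no)
open import Algebra.Bundles using (CommutativeMonoid)
open import Algebra.Properties.CommutativeSemigroup
  (CommutativeMonoid.commutativeSemigroup +-0-commutativeMonoid) using (x∙yz≈y∙xz)

-- ℤtoℚ z is definitionally fromℚᵘ (z / 1), which is compared through toℚᵘ.
ℤtoℚ-mono-≤ : ∀ {a b} → a ℤ.≤ b → ℤtoℚ a ≤ ℤtoℚ b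
ℤtoℚ-mono-≤ {a} {b} a≤b = toℚᵘ-cancel-≤
  (ℚᵘ.≤-respˡ-≃ (ℚᵘ.≃-sym (toℚᵘ-fromℚᵘ (ℚᵘ.mkℚᵘ a 0)))
  (ℚᵘ.≤-respʳ-≃ (ℚᵘ.≃-sym (toℚᵘ-fromℚᵘ (ℚᵘ.mkℚᵘ b 0)))
  (ℚᵘ.*≤* (ℤ.*-monoʳ-≤-nonNeg (+ 1) a≤b))))

ℕtoℚ-suc : ∀ k → ℕtoℚ (suc k) ≡ 1ℚ + ℕtoℚ k
ℕtoℚ-suc k = toℚᵘ-injective (begin-equality
  toℚᵘ (ℕtoℚ (suc k))                  ≃⟨ toℚᵘ-fromℚᵘ (ℚᵘ.mkℚᵘ (+ suc k) 0) ⟩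
  ℚᵘ.mkℚᵘ (+ suc k) 0                  ≃⟨ ℚᵘ.*≡* numerators ⟩
  ℚᵘ.1ℚᵘ ℚᵘ.+ ℚᵘ.mkℚᵘ (+ k) 0          ≃⟨ ℚᵘ.+-cong (ℚᵘ.≃-sym (toℚᵘ-fromℚᵘ ℚᵘ.1ℚᵘ))
                                                       (ℚᵘ.≃-sym (toℚᵘ-fromℚᵘ (ℚᵘ.mkℚᵘ (+ k) 0))) ⟩
  toℚᵘ 1ℚ ℚᵘ.+ toℚᵘ (ℕtoℚ k)            ≃⟨ ℚᵘ.≃-sym (toℚᵘ-homo-+ 1ℚ (ℕtoℚ k)) ⟩
  toℚᵘ (1ℚ + ℕtoℚ k)                   ∎)
  where
  open ℚᵘ.≤-Reasoning
  numerators : + suc k ℤ.* + 1 ≡ (+ 1 ℤ.+ + k ℤ.* + 1) ℤ.* + 1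
  numerators rewrite ℤ.*-identityʳ (+ k) | ℤ.*-identityʳ (+ 1 ℤ.+ + k) = refl

ℕtoℚ-suc-* : ∀ k M → ℕtoℚ (suc k) * M ≡ M + ℕtoℚ k * M
ℕtoℚ-suc-* k M = begin
  ℕtoℚ (suc k) * M       ≡⟨ cong (_* M) (ℕtoℚ-suc k) ⟩
  (1ℚ + ℕtoℚ k) * M      ≡⟨ *-distribʳ-+ M 1ℚ (ℕtoℚ k) ⟩
  1ℚ * M + ℕtoℚ k * M    ≡⟨ cong (_+ ℕtoℚ k * M) (*-identityˡ M) ⟩
  M + ℕtoℚ k * M         ∎
  where open ≡-Reasoning

maxEntry-upper : ∀ {m} (y : Fin (suc m) → ℚ) j → y j ≤ maxEntry y
maxEntry-upper {ℕ.zero} y zero = ≤-refl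
maxEntry-upper {suc m}  y zero = p≤p⊔q (y zero) (maxEntry (λ k → y (suc k)))
maxEntry-upper {suc m}  y (suc j) =
  ≤-trans (maxEntry-upper (λ k → y (suc k)) j) (p≤q⊔p (y zero) (maxEntry (λ k → y (suc k))))

maxEntry-nonNeg : ∀ {m} (y : Fin (suc m) → ℚ) → (∃ λ j → 0ℚ < y j) → 0ℚ ≤ maxEntry y
maxEntry-nonNeg y (j , 0<yj) = <⇒≤ (<-≤-trans 0<yj (maxEntry-upper y j))

ySum-⊤-split : ∀ {n} (y : Fin n → ℚ) S → ySum y ⊤ ≡ ySum y S + ySum y (∁ S)
ySum-⊤-split y [] = sym (+-identityʳ 0ℚ)
ySum-⊤-split y (b ∷ S) = begin
  y zero + ySum y′ ⊤                                 ≡⟨ cong (_+_ (y zero)) (ySum-⊤-split y′ S) ⟩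
  y zero + (ySum y′ S + ySum y′ (∁ S))               ≡⟨ split b ⟩
  (if b then y zero else 0ℚ) + ySum y′ S
    + ((if not b then y zero else 0ℚ) + ySum y′ (∁ S)) ∎
  where
  open ≡-Reasoning
  y′ : Fin _ → ℚ
  y′ j = y (suc j)
  split : ∀ b → y zero + (ySum y′ S + ySum y′ (∁ S))
              ≡ (if b then y zero else 0ℚ) + ySum y′ S
                + ((if not b then y zero else 0ℚ) + ySum y′ (∁ S))
  split true  = trans (sym (+-assoc (y zero) (ySum y′ S) (ySum y′ (∁ S))))
                      (cong (_+_ (y zero + ySum y′ S)) (sym (+-identityˡ (ySum y′ (∁ S)))))
  split false = trans (x∙yz≈y∙xz (y zero) (ySum y′ S) (ySum y′ (∁ S)))
                      (cong (_+ (y zero + ySum y′ (∁ S))) (sym (+-identityˡ (ySum y′ S))))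

select-≤ : ∀ b {x M} → 0ℚ ≤ M → x ≤ M → (if b then x else 0ℚ) ≤ M
select-≤ true  _   x≤M = x≤M
select-≤ false 0≤M _   = 0≤M

ySum-≤ : ∀ {n} (y : Fin n → ℚ) {M} → 0ℚ ≤ M → (∀ j → y j ≤ M) → ∀ T → ySum y T ≤ ℕtoℚ n * M
ySum-≤ y {M} 0≤M y≤M [] = ≤-reflexive (sym (*-zeroˡ M))
ySum-≤ {suc n} y {M} 0≤M y≤M (b ∷ T) = begin
  (if b then y zero else 0ℚ) + ySum y′ T  ≤⟨ +-mono-≤ (select-≤ b 0≤M (y≤M zero))
                                                       (ySum-≤ y′ 0≤M (λ j → y≤M (suc j)) T) ⟩
  M + ℕtoℚ n * M                          ≡⟨ ℕtoℚ-suc-* n M ⟨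
  ℕtoℚ (suc n) * M                        ∎
  where
  open ≤-Reasoning
  y′ : Fin _ → ℚ
  y′ j = y (suc j)

ySum-≤-∋ : ∀ {m} (y : Fin (suc m) → ℚ) {M} → 0ℚ ≤ M → (∀ j → y j ≤ M) →
           ∀ {i T} → i ∈ T → ySum y T ≤ y i + ℕtoℚ m * M
ySum-≤-∋ y 0≤M y≤M {T = _ ∷ T} here =
  +-monoʳ-≤ (y zero) (ySum-≤ (λ j → y (suc j)) 0≤M (λ j → y≤M (suc j)) T)
ySum-≤-∋ {suc m} y {M} 0≤M y≤M {suc i} {b ∷ T} (there i∈T) = begin
  (if b then y zero else 0ℚ) + ySum y′ T  ≤⟨ +-mono-≤ (select-≤ b 0≤M (y≤M zero))
                                                       (ySum-≤-∋ y′ 0≤M (λ j → y≤M (suc j)) i∈T) ⟩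
  M + (y′ i + ℕtoℚ m * M)                 ≡⟨ x∙yz≈y∙xz M (y′ i) (ℕtoℚ m * M) ⟩
  y′ i + (M + ℕtoℚ m * M)                 ≡⟨ cong (_+_ (y′ i)) (ℕtoℚ-suc-* m M) ⟨
  y′ i + ℕtoℚ (suc m) * M                 ∎
  where
  open ≤-Reasoning
  y′ : Fin _ → ℚ
  y′ j = y (suc j)

⊤-inRingFamily : ∀ {n} (A : Digraph n) → InRingFamily A ⊤
⊤-inRingFamily A _ _ _ _ = ∈⊤

ySum-minimizer≤ySum-⊤ : ∀ {n} (A : Digraph n) f y S → InBase f y → IsMinimizer A f S → S ⊂ ⊤ →
                        ySum y S ≤ ySum y ⊤
ySum-minimizer≤ySum-⊤ A f y S (y≤f , y⊤≡f⊤) (_ , S-min) S⊂⊤ = begin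
  ySum y S      ≤⟨ y≤f S S⊂⊤ ⟩
  ℤtoℚ (f S)    ≤⟨ ℤtoℚ-mono-≤ (S-min ⊤ (⊤-inRingFamily A)) ⟩
  ℤtoℚ (f ⊤)    ≡⟨ y⊤≡f⊤ ⟨
  ySum y ⊤      ∎
  where open ≤-Reasoning

mainTheorem16 : (m : ℕ) (f : SetFun (suc m)) → Submodular f → f ⊥ ≡ + 0
    → (A : Digraph (suc m)) → Acyclic A
    → (y : Fin (suc m) → ℚ) → InBase f y → NonDegenerate y
    → (i : Fin (suc m)) → y i < - (ℕtoℚ m * maxEntry y)
    → (S : Subset (suc m)) → IsMinimizer A f S → i ∈ S
mainTheorem16 m f _ _ A _ y y∈B (pos , _) i yi<-K S S-min with i ∈? S
... | yes i∈S = i∈S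
... | no  i∉S = ⊥-elim (<-irrefl refl (begin-strict
  ySum y ⊤                         ≡⟨ ySum-⊤-split y S ⟩
  ySum y S + ySum y (∁ S)          ≤⟨ +-monoʳ-≤ (ySum y S)
                                        (ySum-≤-∋ y (maxEntry-nonNeg y pos) (maxEntry-upper y) (x∉p⇒x∈∁p i∉S)) ⟩
  ySum y S + (y i + K)             <⟨ +-monoʳ-< (ySum y S) (+-monoˡ-< K yi<-K) ⟩
  ySum y S + (- K + K)             ≡⟨ cong (_+_ (ySum y S)) (+-inverseˡ K) ⟩
  ySum y S + 0ℚ                    ≡⟨ +-identityʳ (ySum y S) ⟩
  ySum y S                         ≤⟨ ySum-minimizer≤ySum-⊤ A f y S y∈B S-min (⊆⊤ , i , ∈⊤ , i∉S) ⟩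
  ySum y ⊤                         ∎))
  where
  open ≤-Reasoning
  K = ℕtoℚ m * maxEntry y
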